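{- Let $b > c \geq a \geq 0$ be integers and $((A_i)_{i \in I}, B)$ be an $(a,b,c)$ degenerate set system. Then $|I| \leq \left\lfloor \frac{b-a}{c-a+1} \right\rfloor$.
   Context: For integers $b>c\ge a\ge 0$, an $(a,b,c)$ degenerate set system is a pair $((A_i)_{i\in I},B)$ where $(A_i)_{i\in I}$ is a sequence of finite sets indexed by a finite totally ordered set $I$ and $B$ is a finite set, such that $|B|\le b$, $|A_i\cap B|>c$ for all $i\in I$, and $|A_i\cap\bigcup_{k<i}A_k|\le a$ for all $i\in I$. -}

module Defs where

open import Data.Nat using (ℕ; _≤_; _<_)
open import Data.Fin using (Fin)
open import Data.Fin.Properties using (_<?_)
open import Data.Fin.Subset using (Subset; _∩_; ⋃; ∣_∣)
open import Data.List using (map; filter; allFin)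

-- Finite sets are modelled as subsets of a finite ambient universe Fin n.
-- The index set I (finite, totally ordered) is modelled as Fin m with its
-- usual order; the family (A_i) is a function Fin m → Subset n.

earlierUnion : ∀ {m n} → (Fin m → Subset n) → Fin m → Subset n
earlierUnion {m} A i = ⋃ (map A (filter (_<? i) (allFin m)))

record IsDegenerateSetSystem (a b c : ℕ) {m n : ℕ}
       (A : Fin m → Subset n) (B : Subset n) : Set where
  field
    B-size  : ∣ B ∣ ≤ b
    A∩B-big : ∀ i → c < ∣ (A i ∩ B) ∣
    A∩earlier-small : ∀ i → ∣ (A i ∩ earlierUnion A i) ∣ ≤ a

{-# OPTIONS --safe #-}
-- Let Uᵢ = (A₀ ∪ … ∪ Aᵢ) ∩ B. Adding Aᵢ₊₁ to the union adds more than c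
-- points of B, of which at most a were already in A₀ ∪ … ∪ Aᵢ, so
-- ∣Uᵢ₊₁∣ ≥ ∣Uᵢ∣ + (c − a + 1). As ∣U₀∣ > c, the last union has at least
-- a + ∣I∣(c − a + 1) elements, yet it lies inside B, which has at most b.
module Submission where

open import Defs
open import Data.Empty using (⊥-elim)
open import Data.Fin using (Fin; toℕ; fromℕ<)
open import Data.Fin.Properties using (_<?_; toℕ-fromℕ<)
open import Data.Fin.Subset using (Subset; _∩_; _∪_; ⋃; ∣_∣; _∈_; _⊆_; inside; outside)
open import Data.Fin.Subset.Properties
open import Data.List using (List; []; _∷_; map; filter; allFin)
import Data.List.Membership.Propositional as List
open import Data.List.Membership.Propositional.Properties using (∈-allFin; ∈-map⁺; ∈-map⁻; ∈-filter⁺; ∈-filter⁻)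
open import Data.List.Relation.Unary.Any using (here; there)
open import Data.Nat using (ℕ; _≤_; _<_; _>_; _≥_; _∸_; _+_; _*_; _/_; suc; zero; z≤n; NonZero)
open import Data.Nat.DivMod using (m*n/n≡m; /-monoˡ-≤)
open import Data.Nat.Properties using (≤-refl; +-identityʳ; +-suc; +-comm; +-assoc; +-mono-≤; +-cancelʳ-≤; ≤-trans; ≤-reflexive; <-trans; n<1+n; m+[n∸m]≡n; m+n≤o⇒m≤o∸n)
open import Data.Product using (Σ-syntax; _×_; _,_; proj₁; proj₂)
open import Data.Sum using (inj₁; inj₂)
open import Data.Vec using ([]; _∷_)
open import Relation.Binary.PropositionalEquality using (_≡_; refl; sym; trans; cong; subst₂)

x∈⋃⁺ : ∀ {n} {x : Fin n} {p : Subset n} (ps : List (Subset n)) → p List.∈ ps → x ∈ p → x ∈ ⋃ ps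
x∈⋃⁺ (_ ∷ ps) (here refl) x∈p = x∈p∪q⁺ (inj₁ x∈p)
x∈⋃⁺ (_ ∷ ps) (there p∈ps) x∈p = x∈p∪q⁺ (inj₂ (x∈⋃⁺ ps p∈ps x∈p))

x∈⋃⁻ : ∀ {n} {x : Fin n} (ps : List (Subset n)) → x ∈ ⋃ ps → Σ[ p ∈ Subset n ] p List.∈ ps × x ∈ p
x∈⋃⁻ [] x∈⊥ = ⊥-elim (∉⊥ x∈⊥)
x∈⋃⁻ (p ∷ ps) x∈ with x∈p∪q⁻ p (⋃ ps) x∈
... | inj₁ x∈p = p , here refl , x∈p
... | inj₂ x∈⋃ps with x∈⋃⁻ ps x∈⋃ps
...   | q , q∈ps , x∈q = q , there q∈ps , x∈q

∣p∪q∣+∣p∩q∣≡∣p∣+∣q∣ : ∀ {n} (p q : Subset n) → ∣ p ∪ q ∣ + ∣ p ∩ q ∣ ≡ ∣ p ∣ + ∣ q ∣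
∣p∪q∣+∣p∩q∣≡∣p∣+∣q∣ [] [] = refl
∣p∪q∣+∣p∩q∣≡∣p∣+∣q∣ (outside ∷ p) (outside ∷ q) = ∣p∪q∣+∣p∩q∣≡∣p∣+∣q∣ p q
∣p∪q∣+∣p∩q∣≡∣p∣+∣q∣ (outside ∷ p) (inside ∷ q) =
  trans (cong suc (∣p∪q∣+∣p∩q∣≡∣p∣+∣q∣ p q)) (sym (+-suc _ _))
∣p∪q∣+∣p∩q∣≡∣p∣+∣q∣ (inside ∷ p) (outside ∷ q) = cong suc (∣p∪q∣+∣p∩q∣≡∣p∣+∣q∣ p q)
∣p∪q∣+∣p∩q∣≡∣p∣+∣q∣ (inside ∷ p) (inside ∷ q) =
  cong suc (trans (+-suc _ _) (trans (cong suc (∣p∪q∣+∣p∩q∣≡∣p∣+∣q∣ p q)) (sym (+-suc _ _))))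

∣p∩r∣+∣q∩r∣≤∣[p∪q]∩r∣+∣q∩p∣ : ∀ {n} (p q r : Subset n) → ∣ p ∩ r ∣ + ∣ q ∩ r ∣ ≤ ∣ (p ∪ q) ∩ r ∣ + ∣ q ∩ p ∣
∣p∩r∣+∣q∩r∣≤∣[p∪q]∩r∣+∣q∩p∣ p q r = begin
  ∣ p ∩ r ∣ + ∣ q ∩ r ∣                            ≡⟨ ∣p∪q∣+∣p∩q∣≡∣p∣+∣q∣ (p ∩ r) (q ∩ r) ⟨
  ∣ (p ∩ r) ∪ (q ∩ r) ∣ + ∣ (p ∩ r) ∩ (q ∩ r) ∣    ≡⟨ cong (λ s → ∣ s ∣ + ∣ (p ∩ r) ∩ (q ∩ r) ∣) (∩-distribʳ-∪ r p q) ⟨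
  ∣ (p ∪ q) ∩ r ∣ + ∣ (p ∩ r) ∩ (q ∩ r) ∣          ≤⟨ +-mono-≤ ≤-refl (p⊆q⇒∣p∣≤∣q∣ [p∩r]∩[q∩r]⊆q∩p) ⟩
  ∣ (p ∪ q) ∩ r ∣ + ∣ q ∩ p ∣                      ∎
  where
  open Data.Nat.Properties.≤-Reasoning
  [p∩r]∩[q∩r]⊆q∩p : (p ∩ r) ∩ (q ∩ r) ⊆ q ∩ p
  [p∩r]∩[q∩r]⊆q∩p x∈ with x∈p∩q⁻ (p ∩ r) (q ∩ r) x∈
  ... | x∈p∩r , x∈q∩r = x∈p∩q⁺ (proj₁ (x∈p∩q⁻ q r x∈q∩r) , proj₁ (x∈p∩q⁻ p r x∈p∩r))

p⊆q⇒p∩r⊆q∩r : ∀ {n} {p q r : Subset n} → p ⊆ q → p ∩ r ⊆ q ∩ r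
p⊆q⇒p∩r⊆q∩r {p = p} {r = r} p⊆q x∈ with x∈p∩q⁻ p r x∈
... | x∈p , x∈r = x∈p∩q⁺ (p⊆q x∈p , x∈r)

m*n≤o⇒m≤o/n : ∀ m {n o} .{{_ : NonZero n}} → m * n ≤ o → m ≤ o / n
m*n≤o⇒m≤o/n m {n} m*n≤o = ≤-trans (≤-reflexive (sym (m*n/n≡m m n))) (/-monoˡ-≤ n m*n≤o)

module _ {m n} (A : Fin m → Subset n) where

  x∈earlierUnion⁺ : ∀ {x} {j} i → toℕ i < toℕ j → x ∈ A i → x ∈ earlierUnion A j
  x∈earlierUnion⁺ {j = j} i i<j =
    x∈⋃⁺ (map A (filter (_<? j) (allFin m))) (∈-map⁺ A (∈-filter⁺ (_<? j) (∈-allFin i) i<j))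

  x∈earlierUnion⁻ : ∀ {x} j → x ∈ earlierUnion A j → Σ[ i ∈ Fin m ] toℕ i < toℕ j × x ∈ A i
  x∈earlierUnion⁻ j x∈ with x∈⋃⁻ (map A (filter (_<? j) (allFin m))) x∈
  ... | _ , Ai∈ , x∈Ai with ∈-map⁻ A Ai∈
  ...   | i , i∈ , refl = i , proj₂ (∈-filter⁻ (_<? j) {xs = allFin m} i∈) , x∈Ai

  unionUpTo : Fin m → Subset n
  unionUpTo i = earlierUnion A i ∪ A i

  unionUpTo⊆earlierUnion : ∀ {i j} → toℕ i < toℕ j → unionUpTo i ⊆ earlierUnion A j
  unionUpTo⊆earlierUnion {i} {j} i<j x∈ with x∈p∪q⁻ (earlierUnion A i) (A i) x∈
  ... | inj₂ x∈Ai = x∈earlierUnion⁺ i i<j x∈Ai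
  ... | inj₁ x∈earlier with x∈earlierUnion⁻ i x∈earlier
  ...   | k , k<i , x∈Ak = x∈earlierUnion⁺ k (<-trans k<i i<j) x∈Ak

module _ {a b c m n} {A : Fin m → Subset n} {B : Subset n}
         (c≥a : c ≥ a) (D : IsDegenerateSetSystem a b c A B) where

  open IsDegenerateSetSystem D

  a+[1+c∸a]≡1+c : a + suc (c ∸ a) ≡ suc c
  a+[1+c∸a]≡1+c = trans (+-suc a (c ∸ a)) (cong suc (m+[n∸m]≡n c≥a))

  ∣unionUpTo∩B∣-growth : ∀ j (j<m : j < m) → suc j * suc (c ∸ a) + a ≤ ∣ unionUpTo A (fromℕ< j<m) ∩ B ∣
  ∣unionUpTo∩B∣-growth zero j<m = begin
    suc (c ∸ a) + 0 + a                 ≡⟨ cong (_+ a) (+-identityʳ _) ⟩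
    suc (c ∸ a) + a                     ≡⟨ +-comm (suc (c ∸ a)) a ⟩
    a + suc (c ∸ a)                     ≡⟨ a+[1+c∸a]≡1+c ⟩
    suc c                               ≤⟨ A∩B-big i ⟩
    ∣ A i ∩ B ∣                         ≤⟨ p⊆q⇒∣p∣≤∣q∣ (p⊆q⇒p∩r⊆q∩r (q⊆p∪q (earlierUnion A i) (A i))) ⟩
    ∣ unionUpTo A i ∩ B ∣               ∎
    where
    open Data.Nat.Properties.≤-Reasoning
    i = fromℕ< j<m
  ∣unionUpTo∩B∣-growth (suc j) j+1<m = +-cancelʳ-≤ a _ _ (begin
    d + suc j * d + a + a               ≡⟨ cong (_+ a) (trans (+-assoc d _ a) (+-comm d _)) ⟩
    suc j * d + a + d + a               ≡⟨ +-assoc (suc j * d + a) d a ⟩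
    (suc j * d + a) + (d + a)           ≡⟨ cong (suc j * d + a +_) (trans (+-comm d a) a+[1+c∸a]≡1+c) ⟩
    (suc j * d + a) + suc c             ≤⟨ +-mono-≤ previous (A∩B-big i) ⟩
    ∣ earlierUnion A i ∩ B ∣ + ∣ A i ∩ B ∣  ≤⟨ ∣p∩r∣+∣q∩r∣≤∣[p∪q]∩r∣+∣q∩p∣ (earlierUnion A i) (A i) B ⟩
    ∣ unionUpTo A i ∩ B ∣ + ∣ A i ∩ earlierUnion A i ∣  ≤⟨ +-mono-≤ ≤-refl (A∩earlier-small i) ⟩
    ∣ unionUpTo A i ∩ B ∣ + a           ∎)
    where
    open Data.Nat.Properties.≤-Reasoning
    d = suc (c ∸ a)
    j<m = <-trans (n<1+n j) j+1<m
    i = fromℕ< j+1<m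
    i-1<i : toℕ (fromℕ< j<m) < toℕ i
    i-1<i = subst₂ _<_ (sym (toℕ-fromℕ< j<m)) (sym (toℕ-fromℕ< j+1<m)) (n<1+n j)
    previous : suc j * d + a ≤ ∣ earlierUnion A i ∩ B ∣
    previous = ≤-trans (∣unionUpTo∩B∣-growth j j<m) (p⊆q⇒∣p∣≤∣q∣ (p⊆q⇒p∩r⊆q∩r (unionUpTo⊆earlierUnion A i-1<i)))

lemma5 : (a b c : ℕ) → b > c → c ≥ a → (m n : ℕ) → (A : Fin m → Subset n) → (B : Subset n) →
    IsDegenerateSetSystem a b c A B → m ≤ (b ∸ a) / suc (c ∸ a)
lemma5 a b c b>c c≥a zero n A B D = z≤n
lemma5 a b c b>c c≥a (suc m) n A B D =
  m*n≤o⇒m≤o/n (suc m) (m+n≤o⇒m≤o∸n (suc m * suc (c ∸ a)) (begin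
    suc m * suc (c ∸ a) + a       ≤⟨ ∣unionUpTo∩B∣-growth c≥a D m m<1+m ⟩
    ∣ unionUpTo A last ∩ B ∣      ≤⟨ ∣p∩q∣≤∣q∣ (unionUpTo A last) B ⟩
    ∣ B ∣                         ≤⟨ B-size ⟩
    b                             ∎))
  where
  open Data.Nat.Properties.≤-Reasoning
  open IsDegenerateSetSystem D
  m<1+m = n<1+n m
  last = fromℕ< m<1+m
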